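{- Let $\lesssim$ be a plausible preorder on $\mathcal{T}$ with equivalence part $\sim$. Let $p_1,\dots,p_n$ be positive real numbers and $A_1,\dots,A_n$ events such that $0\sim\sum_{i=1}^n p_iA_i$. Then $0\sim A_i$ for every $i\in\{1,\dots,n\}$.
   Context: Random quantities: $\mathcal{T}$ is a unital associative commutative algebra over $\mathbb{R}$; reals $r$ are identified with $r\mathbf{1}$; products are written $X.Y$. Events: idempotents $A$ ($A.A=A$). Plausible preorder: a relation $\lesssim$ on $\mathcal{T}$ with (i) $0\lesssim A$ for every event $A$; (ii) $0\lesssim X$ and $0\lesssim Y$ imply $0\lesssim X+Y$; (iii) $0\lesssim X$ and real $q\ge0$ imply $0\lesssim qX$; (iv) $X\lesssim Y$ iff $0\lesssim Y-X$. Equivalence part: $X\sim Y$ iff $X\lesssim Y$ and $Y\lesssim X$. -}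

module Defs where

open import Level using (0ℓ)
open import Data.Nat using (ℕ; zero; suc)
open import Data.Fin using (Fin; zero; suc)
open import Data.Product using (Σ; _×_; _,_)
open import Data.Sum using (_⊎_)
open import Relation.Nullary using (¬_)
open import Relation.Binary.PropositionalEquality using (_≡_)
open import Algebra.Structures using (IsCommutativeRing)

-- The real numbers, given axiomatically as a complete ordered field
-- (any model is isomorphic to ℝ). Equality is propositional equality.
record Reals : Set₁ where
  infixl 6 _+_
  infixl 7 _*_
  infix  4 _≤_
  field
    ℝ    : Set
    _+_  : ℝ → ℝ → ℝ
    _*_  : ℝ → ℝ → ℝ
    -_   : ℝ → ℝ
    0ℝ   : ℝ
    1ℝ   : ℝ
    isCommutativeRing : IsCommutativeRing _≡_ _+_ _*_ -_ 0ℝ 1ℝ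
    0≢1  : ¬ (0ℝ ≡ 1ℝ)
    inv  : (x : ℝ) → ¬ (x ≡ 0ℝ) → ℝ
    inv-* : (x : ℝ) (x≢0 : ¬ (x ≡ 0ℝ)) → x * inv x x≢0 ≡ 1ℝ
    _≤_  : ℝ → ℝ → Set
    ≤-refl    : ∀ x → x ≤ x
    ≤-trans   : ∀ {x y z} → x ≤ y → y ≤ z → x ≤ z
    ≤-antisym : ∀ {x y} → x ≤ y → y ≤ x → x ≡ y
    ≤-total   : ∀ x y → (x ≤ y) ⊎ (y ≤ x)
    +-mono-≤  : ∀ {x y} z → x ≤ y → x + z ≤ y + z
    *-nonneg  : ∀ {x y} → 0ℝ ≤ x → 0ℝ ≤ y → 0ℝ ≤ x * y
    sup : (P : ℝ → Set) → Σ ℝ P → Σ ℝ (λ b → ∀ x → P x → x ≤ b) →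
          Σ ℝ (λ s → (∀ x → P x → x ≤ s) × (∀ b → (∀ x → P x → x ≤ b) → s ≤ b))
  _<_ : ℝ → ℝ → Set
  x < y = (x ≤ y) × ¬ (x ≡ y)

record RAlgebra (R : Reals) : Set₁ where
  open Reals R using (ℝ; 1ℝ) renaming (_+_ to _+ℝ_; _*_ to _*ℝ_)
  infixl 6 _+_
  infixl 7 _∙_
  infixr 8 _·_
  field
    T    : Set
    _+_  : T → T → T
    _∙_  : T → T → T
    -_   : T → T
    𝟘    : T
    𝟙    : T
    isCommutativeRing : IsCommutativeRing _≡_ _+_ _∙_ -_ 𝟘 𝟙
    _·_  : ℝ → T → T
    ·-distrib-+ᵀ : ∀ r X Y → r · (X + Y) ≡ r · X + r · Y
    ·-distrib-+ℝ : ∀ r s X → (r +ℝ s) · X ≡ r · X + s · X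
    ·-assoc      : ∀ r s X → (r *ℝ s) · X ≡ r · (s · X)
    ·-identity   : ∀ X → 1ℝ · X ≡ X
    ·-∙-assoc    : ∀ r X Y → r · (X ∙ Y) ≡ (r · X) ∙ Y
  ι : ℝ → T
  ι r = r · 𝟙
  _-_ : T → T → T
  X - Y = X + (- Y)
  IsEvent : T → Set
  IsEvent A = A ∙ A ≡ A
  ∑ : (n : ℕ) → (Fin n → T) → T
  ∑ zero    f = 𝟘
  ∑ (suc n) f = f zero + ∑ n (λ i → f (suc i))

record PlausiblePreorder {R : Reals} (𝒯 : RAlgebra R) : Set₁ where
  open Reals R using (ℝ; 0ℝ; _≤_)
  open RAlgebra 𝒯
  infix 4 _≲_ _∼_
  field
    _≲_ : T → T → Set
    event-nonneg : ∀ A → IsEvent A → 𝟘 ≲ A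
    add-nonneg   : ∀ X Y → 𝟘 ≲ X → 𝟘 ≲ Y → 𝟘 ≲ X + Y
    scale-nonneg : ∀ X (q : ℝ) → 0ℝ ≤ q → 𝟘 ≲ X → 𝟘 ≲ q · X
    ≲⇔          : ∀ X Y → (X ≲ Y → 𝟘 ≲ Y - X) × (𝟘 ≲ Y - X → X ≲ Y)
  _∼_ : T → T → Set
  X ∼ Y = (X ≲ Y) × (Y ≲ X)

-- Every summand p i · A i is nonnegative, so each one lies below the whole sum,
-- which by hypothesis lies below 𝟘; hence p i · A i ≲ 𝟘. Scaling by the
-- nonnegative real p i⁻¹ gives A i ≲ 𝟘, and 𝟘 ≲ A i holds because A i is an event.
module Submission where

open import Defs
open import Data.Nat using (ℕ; zero; suc)
open import Data.Fin using (Fin; zero; suc)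
open import Data.Product using (_,_; proj₁; proj₂)
open import Data.Sum using (inj₁; inj₂)
open import Relation.Nullary using (¬_; contradiction)
open import Relation.Binary.PropositionalEquality
open import Algebra.Bundles using (CommutativeRing)
import Algebra.Properties.Ring as RingProperties
import Algebra.Properties.AbelianGroup as AbelianGroupProperties

ℝ-commutativeRing : Reals → CommutativeRing _ _
ℝ-commutativeRing R = record { isCommutativeRing = Reals.isCommutativeRing R }

T-commutativeRing : {R : Reals} → RAlgebra R → CommutativeRing _ _
T-commutativeRing 𝒯 = record { isCommutativeRing = RAlgebra.isCommutativeRing 𝒯 }

module OrderedFieldProperties (R : Reals) where
  open Reals R
  open CommutativeRing (ℝ-commutativeRing R) using (+-identityˡ; -‿inverseˡ; -‿inverseʳ)
  open RingProperties (CommutativeRing.ring (ℝ-commutativeRing R)) using (-1*x≈-x; -‿involutive; -‿distribʳ-*)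

  x≤0⇒0≤-x : ∀ {x} → x ≤ 0ℝ → 0ℝ ≤ - x
  x≤0⇒0≤-x {x} x≤0 = subst₂ _≤_ (-‿inverseʳ x) (+-identityˡ (- x)) (+-mono-≤ (- x) x≤0)

  0≤-x⇒x≤0 : ∀ {x} → 0ℝ ≤ - x → x ≤ 0ℝ
  0≤-x⇒x≤0 {x} 0≤-x = subst₂ _≤_ (+-identityˡ x) (-‿inverseˡ x) (+-mono-≤ x 0≤-x)

  0≰-1 : ¬ 0ℝ ≤ - 1ℝ
  0≰-1 0≤-1 = 0≢1 (≤-antisym 0≤1 (0≤-x⇒x≤0 0≤-1))
    where
      0≤1 : 0ℝ ≤ 1ℝ
      0≤1 = subst (0ℝ ≤_) (trans (-1*x≈-x (- 1ℝ)) (-‿involutive 1ℝ)) (*-nonneg 0≤-1 0≤-1)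

  0<x⇒x≢0 : ∀ {x} → 0ℝ < x → ¬ x ≡ 0ℝ
  0<x⇒x≢0 (_ , 0≢x) x≡0 = 0≢x (sym x≡0)

  inv-nonneg : ∀ {x} (0<x : 0ℝ < x) → 0ℝ ≤ inv x (0<x⇒x≢0 0<x)
  inv-nonneg {x} 0<x with ≤-total 0ℝ (inv x (0<x⇒x≢0 0<x))
  ... | inj₁ 0≤x⁻¹ = 0≤x⁻¹
  ... | inj₂ x⁻¹≤0 = contradiction 0≤-1 0≰-1
    where
      0≤-1 : 0ℝ ≤ - 1ℝ
      0≤-1 = subst (0ℝ ≤_)
        (trans (sym (-‿distribʳ-* x _)) (cong -_ (inv-* x (0<x⇒x≢0 0<x))))
        (*-nonneg (proj₁ 0<x) (x≤0⇒0≤-x x⁻¹≤0))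

module ScalarProperties {R : Reals} (𝒯 : RAlgebra R) where
  open Reals R using (1ℝ; inv; inv-*) renaming (_*_ to _*ℝ_)
  open RAlgebra 𝒯
  open CommutativeRing (T-commutativeRing 𝒯) using (+-identityˡ; -‿inverseʳ; +-abelianGroup)
  open RingProperties (CommutativeRing.ring (T-commutativeRing 𝒯)) using (x+x≈x⇒x≈0)
  open AbelianGroupProperties +-abelianGroup using (inverseʳ-unique)

  ·-zeroʳ : ∀ r → r · 𝟘 ≡ 𝟘
  ·-zeroʳ r = x+x≈x⇒x≈0 (r · 𝟘) (trans (sym (·-distrib-+ᵀ r 𝟘 𝟘)) (cong (r ·_) (+-identityˡ 𝟘)))

  -‿distrib-· : ∀ r X → r · (- X) ≡ - (r · X)
  -‿distrib-· r X = inverseʳ-unique (r · X) (r · (- X))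
    (trans (sym (·-distrib-+ᵀ r X (- X))) (trans (cong (r ·_) (-‿inverseʳ X)) (·-zeroʳ r)))

  r·[X-Y]≡r·X-r·Y : ∀ r X Y → r · (X - Y) ≡ (r · X) - (r · Y)
  r·[X-Y]≡r·X-r·Y r X Y = trans (·-distrib-+ᵀ r X (- Y)) (cong (r · X +_) (-‿distrib-· r Y))

  inv·[x·X]≡X : ∀ x x≢0 X → inv x x≢0 · (x · X) ≡ X
  inv·[x·X]≡X x x≢0 X = begin
    inv x x≢0 · (x · X)      ≡⟨ sym (·-assoc (inv x x≢0) x X) ⟩
    (inv x x≢0 *ℝ x) · X     ≡⟨ cong (_· X) (trans (*-comm (inv x x≢0) x) (inv-* x x≢0)) ⟩
    1ℝ · X                   ≡⟨ ·-identity X ⟩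
    X                        ∎
    where
      open ≡-Reasoning
      open CommutativeRing (ℝ-commutativeRing R) using (*-comm)

module PlausiblePreorderProperties {R : Reals} {𝒯 : RAlgebra R} (P : PlausiblePreorder 𝒯) where
  open Reals R using (0ℝ; _≤_)
  open RAlgebra 𝒯
  open PlausiblePreorder P
  open ScalarProperties 𝒯
  open CommutativeRing (T-commutativeRing 𝒯) using (+-comm; +-assoc; +-identityˡ; -‿inverseˡ; zeroˡ; +-abelianGroup)
  open AbelianGroupProperties +-abelianGroup using (xyx⁻¹≈y)

  ≲⇒0≲- : ∀ {X Y} → X ≲ Y → 𝟘 ≲ Y - X
  ≲⇒0≲- {X} {Y} = proj₁ (≲⇔ X Y)

  0≲-⇒≲ : ∀ {X Y} → 𝟘 ≲ Y - X → X ≲ Y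
  0≲-⇒≲ {X} {Y} = proj₂ (≲⇔ X Y)

  [Y-X]+[Z-Y]≡Z-X : ∀ X Y Z → (Y - X) + (Z - Y) ≡ Z - X
  [Y-X]+[Z-Y]≡Z-X X Y Z = begin
    (Y - X) + (Z - Y)        ≡⟨ +-comm (Y - X) (Z - Y) ⟩
    (Z - Y) + (Y - X)        ≡⟨ +-assoc Z (- Y) (Y - X) ⟩
    Z + (- Y + (Y - X))      ≡⟨ cong (Z +_) (sym (+-assoc (- Y) Y (- X))) ⟩
    Z + ((- Y + Y) - X)      ≡⟨ cong (λ W → Z + (W - X)) (-‿inverseˡ Y) ⟩
    Z + (𝟘 - X)              ≡⟨ cong (Z +_) (+-identityˡ (- X)) ⟩
    Z - X                    ∎
    where open ≡-Reasoning

  ≲-trans : ∀ {X Y Z} → X ≲ Y → Y ≲ Z → X ≲ Z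
  ≲-trans {X} {Y} {Z} X≲Y Y≲Z = 0≲-⇒≲ (subst (𝟘 ≲_) ([Y-X]+[Z-Y]≡Z-X X Y Z)
    (add-nonneg _ _ (≲⇒0≲- X≲Y) (≲⇒0≲- Y≲Z)))

  ≲𝟘-scale : ∀ {X} q → 0ℝ ≤ q → X ≲ 𝟘 → q · X ≲ 𝟘
  ≲𝟘-scale {X} q 0≤q X≲𝟘 = 0≲-⇒≲ (subst (𝟘 ≲_)
    (trans (r·[X-Y]≡r·X-r·Y q 𝟘 X) (cong (_- (q · X)) (·-zeroʳ q)))
    (scale-nonneg _ q 0≤q (≲⇒0≲- X≲𝟘)))

  scaled-event-nonneg : ∀ {q A} → 0ℝ ≤ q → IsEvent A → 𝟘 ≲ q · A
  scaled-event-nonneg {q} {A} 0≤q A-event = scale-nonneg A q 0≤q (event-nonneg A A-event)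

  ∑-nonneg : ∀ n (f : Fin n → T) → (∀ j → 𝟘 ≲ f j) → 𝟘 ≲ ∑ n f
  ∑-nonneg zero    f f≳0 = event-nonneg 𝟘 (zeroˡ 𝟘)
  ∑-nonneg (suc n) f f≳0 = add-nonneg _ _ (f≳0 zero) (∑-nonneg n (λ j → f (suc j)) (λ j → f≳0 (suc j)))

  summand-≲-∑ : ∀ n (f : Fin n → T) → (∀ j → 𝟘 ≲ f j) → ∀ i → f i ≲ ∑ n f
  summand-≲-∑ (suc n) f f≳0 zero = 0≲-⇒≲ (subst (𝟘 ≲_) (sym (xyx⁻¹≈y (f zero) _))
    (∑-nonneg n (λ j → f (suc j)) (λ j → f≳0 (suc j))))
  summand-≲-∑ (suc n) f f≳0 (suc i) = 0≲-⇒≲ (subst (𝟘 ≲_) (sym (+-assoc (f zero) _ _))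
    (add-nonneg _ _ (f≳0 zero)
      (≲⇒0≲- (summand-≲-∑ n (λ j → f (suc j)) (λ j → f≳0 (suc j)) i))))

mainTheorem20 : (R : Reals) (𝒯 : RAlgebra R) (P : PlausiblePreorder 𝒯)
    (n : ℕ) (p : Fin n → Reals.ℝ R) (A : Fin n → RAlgebra.T 𝒯) →
    (∀ i → Reals._<_ R (Reals.0ℝ R) (p i)) →
    (∀ i → RAlgebra.IsEvent 𝒯 (A i)) →
    PlausiblePreorder._∼_ P (RAlgebra.𝟘 𝒯)
      (RAlgebra.∑ 𝒯 n (λ i → RAlgebra._·_ 𝒯 (p i) (A i))) →
    ∀ i → PlausiblePreorder._∼_ P (RAlgebra.𝟘 𝒯) (A i)
mainTheorem20 R 𝒯 P n p A 0<p A-event (_ , ∑≲𝟘) i = event-nonneg (A i) (A-event i) , A≲𝟘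
  where
    open Reals R using (inv)
    open RAlgebra 𝒯
    open PlausiblePreorder P
    open OrderedFieldProperties R
    open ScalarProperties 𝒯
    open PlausiblePreorderProperties P

    p·A≲𝟘 : p i · A i ≲ 𝟘
    p·A≲𝟘 = ≲-trans
      (summand-≲-∑ n (λ j → p j · A j) (λ j → scaled-event-nonneg (proj₁ (0<p j)) (A-event j)) i)
      ∑≲𝟘

    A≲𝟘 : A i ≲ 𝟘
    A≲𝟘 = subst (_≲ 𝟘) (inv·[x·X]≡X (p i) (0<x⇒x≢0 (0<p i)) (A i))
      (≲𝟘-scale (inv (p i) (0<x⇒x≢0 (0<p i))) (inv-nonneg (0<p i)) p·A≲𝟘)
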